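{- Let $K\ge1$ be an integer with $K\equiv \pm1\pmod 6$, and let $p_1^{a_1}\cdots p_r^{a_r}$ be the prime factorization of $K^2+4$. If $m=24\cdot p_1^{j_1}\cdots p_r^{j_r}$ for some integers $j_1,\dots,j_r\ge 0$, then $\pi_K(m)=m$.
   Context: The $K$-Fibonacci sequence is $F_{K,0}=0$, $F_{K,1}=1$, $F_{K,n}=K F_{K,n-1}+F_{K,n-2}$; for an integer $m>1$, $\pi_K(m)$ is the length of its shortest period modulo $m$. -}

module Defs where

open import Data.Nat using (ℕ; zero; suc; _+_; _*_; _≤_; _%_; NonZero)
open import Data.Nat.Divisibility using (_∣_)
open import Data.Nat.Primality using (Prime)
open import Relation.Binary.PropositionalEquality using (_≡_)
open import Data.Product using (_×_)

KFib : ℕ → ℕ → ℕ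
KFib K zero = 0
KFib K (suc zero) = 1
KFib K (suc (suc n)) = K * KFib K (suc n) + KFib K n

IsPeriod : (K m : ℕ) → .{{NonZero m}} → ℕ → Set
IsPeriod K m t = (1 ≤ t) × (∀ n → KFib K (n + t) % m ≡ KFib K n % m)

IsPisano : (K m : ℕ) → .{{NonZero m}} → ℕ → Set
IsPisano K m t = IsPeriod K m t × (∀ s → IsPeriod K m s → t ≤ s)

-- every prime factor of d is a prime factor of n
-- (i.e. d = p₁^j₁ ⋯ p_r^j_r with p_i the primes of n, j_i ≥ 0)
PrimeSupportIn : ℕ → ℕ → Set
PrimeSupportIn d n = ∀ p → Prime p → p ∣ d → p ∣ n

{-# OPTIONS --safe #-}
module Submission where

-- Work in ℤ[t] = ℤ[x]/(x² − K x − 1), where t^(n+1) = F n + F (n+1) t. A positive s is a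
-- period of F modulo m exactly when t^s ≡ 1 (mod m), so the theorem says that t has order
-- exactly 24 d modulo 24 d. Modulo 24 this is a finite computation over the residues of K.
-- The primes of D = K² + 4 differ from 2 and 3, and (t⁴ − 1)² = D K² t⁴ because
-- t⁴ − 1 = K t (K t + 2) and (K t + 2)² = D t². So if 4 ∣ m and t^m = 1 + m Y, then D
-- divides (m Y)² = m Z, and every prime of D divides Z. By the binomial theorem
-- t^(n m) = 1 + m (n Y + Z ((n choose 2) + (n choose 3) m Y + (m Y)² S)). For a prime p ∣ D
-- the factor after Z is divisible by p, so t^(p m) = 1 + p m Y′ with Y′ ≡ Y modulo every
-- prime of D. As long as Y is nonzero modulo each of these primes, t^(w m) ≡ 1 (mod p m)
-- forces p ∣ w Y and hence p ∣ w. Induction over the prime factors of d finishes the proof.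

open import Algebra.Bundles using (CommutativeRing)
open import Algebra.Structures using (IsCommutativeRing)
import Algebra.Properties.Group as GroupProperties
import Algebra.Properties.Semiring.Exp as SemiringExp
import Algebra.Solver.Ring as RingSolver
open import Algebra.Solver.Ring.AlmostCommutativeRing
  using (fromCommutativeRing; _-Raw-AlmostCommutative⟶_)
open import Data.Integer as ℤ using (ℤ; +_; -[1+_]; 0ℤ; 1ℤ)
import Data.Integer.Properties as ℤ
import Data.Integer.Divisibility.Signed as ℤ
open import Data.Integer.Tactic.RingSolver using (solve-∀)
import Data.Maybe as Maybe
import Data.Nat as ℕ
import Data.Nat.Combinatorics as ℕ
import Data.Nat.DivMod as ℕ
import Data.Nat.Divisibility as ℕ
import Data.Nat.Properties as ℕ
import Data.Nat.Tactic.RingSolver as ℕ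
open import Data.Nat.Primality using (Prime; euclidsLemma)
open import Data.Product using (_×_; _,_; proj₁; proj₂; ∃-syntax)
open import Data.Sum using (_⊎_; inj₁; inj₂; [_,_]′)
open import Level using (0ℓ)
open import Relation.Binary.PropositionalEquality
open import Relation.Nullary.Decidable using (dec⇒maybe)

module QuadraticRing (K : ℤ) where

  open import Data.Integer.Base using (_+_; _*_; -_)
  open import Data.Integer.Divisibility.Signed using (_∣_; divides)

  -- ⟨ a , b ⟩ stands for a + b t. Without η the operations below only compute on explicit
  -- constructors, which keeps the terms produced by the ring solver from being unfolded.
  record R : Set where
    no-eta-equality
    pattern
    constructor ⟨_,_⟩
    field
      c₀ c₁ : ℤ

  infixl 6 _⊕_
  infixl 7 _⊗_
  infix 8 ⊝_

  _⊕_ : R → R → R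
  ⟨ a , b ⟩ ⊕ ⟨ c , d ⟩ = ⟨ a + c , b + d ⟩

  _⊗_ : R → R → R
  ⟨ a , b ⟩ ⊗ ⟨ c , d ⟩ = ⟨ a * c + b * d , a * d + b * c + K * (b * d) ⟩

  ⊝_ : R → R
  ⊝ ⟨ a , b ⟩ = ⟨ - a , - b ⟩

  𝟘 𝟙 : R
  𝟘 = ⟨ 0ℤ , 0ℤ ⟩
  𝟙 = ⟨ 1ℤ , 0ℤ ⟩

  ι : ℤ → R
  ι a = ⟨ a , 0ℤ ⟩

  isCommutativeRing : IsCommutativeRing _≡_ _⊕_ _⊗_ ⊝_ 𝟘 𝟙
  isCommutativeRing = record
    { isRing = record
      { +-isAbelianGroup = record
        { isGroup = record
          { isMonoid = record
            { isSemigroup = record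
              { isMagma = record { isEquivalence = isEquivalence ; ∙-cong = cong₂ _⊕_ }
              ; assoc = λ { ⟨ a , b ⟩ ⟨ c , d ⟩ ⟨ e , f ⟩ →
                              cong₂ ⟨_,_⟩ (ℤ.+-assoc a c e) (ℤ.+-assoc b d f) } }
            ; identity = (λ { ⟨ a , b ⟩ → cong₂ ⟨_,_⟩ (ℤ.+-identityˡ a) (ℤ.+-identityˡ b) })
                       , (λ { ⟨ a , b ⟩ → cong₂ ⟨_,_⟩ (ℤ.+-identityʳ a) (ℤ.+-identityʳ b) }) }
          ; inverse = (λ { ⟨ a , b ⟩ → cong₂ ⟨_,_⟩ (ℤ.+-inverseˡ a) (ℤ.+-inverseˡ b) })
                    , (λ { ⟨ a , b ⟩ → cong₂ ⟨_,_⟩ (ℤ.+-inverseʳ a) (ℤ.+-inverseʳ b) })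
          ; ⁻¹-cong = cong ⊝_ }
        ; comm = λ { ⟨ a , b ⟩ ⟨ c , d ⟩ → cong₂ ⟨_,_⟩ (ℤ.+-comm a c) (ℤ.+-comm b d) } }
      ; *-cong = cong₂ _⊗_
      ; *-assoc = ⊗-assoc
      ; *-identity = ⊗-identityˡ , λ X → trans (⊗-comm X 𝟙) (⊗-identityˡ X)
      ; distrib = ⊗-distribˡ , λ X Y Z → trans (⊗-comm (Y ⊕ Z) X)
                    (trans (⊗-distribˡ X Y Z) (cong₂ _⊕_ (⊗-comm X Y) (⊗-comm X Z))) }
    ; *-comm = ⊗-comm }
    where
    ⊗-assoc : ∀ X Y Z → (X ⊗ Y) ⊗ Z ≡ X ⊗ (Y ⊗ Z)
    ⊗-assoc ⟨ a , b ⟩ ⟨ c , d ⟩ ⟨ e , f ⟩ =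
      cong₂ ⟨_,_⟩ (lemma₁ K a b c d e f) (lemma₂ K a b c d e f)
      where
      lemma₁ : ∀ k a b c d e f → (a * c + b * d) * e + (a * d + b * c + k * (b * d)) * f
                               ≡ a * (c * e + d * f) + b * (c * f + d * e + k * (d * f))
      lemma₁ = solve-∀
      lemma₂ : ∀ k a b c d e f →
        (a * c + b * d) * f + (a * d + b * c + k * (b * d)) * e
          + k * ((a * d + b * c + k * (b * d)) * f)
        ≡ a * (c * f + d * e + k * (d * f)) + b * (c * e + d * f)
          + k * (b * (c * f + d * e + k * (d * f)))
      lemma₂ = solve-∀
    ⊗-comm : ∀ X Y → X ⊗ Y ≡ Y ⊗ X
    ⊗-comm ⟨ a , b ⟩ ⟨ c , d ⟩ = cong₂ ⟨_,_⟩ (lemma₁ a b c d) (lemma₂ K a b c d)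
      where
      lemma₁ : ∀ a b c d → a * c + b * d ≡ c * a + d * b
      lemma₁ = solve-∀
      lemma₂ : ∀ k a b c d → a * d + b * c + k * (b * d) ≡ c * b + d * a + k * (d * b)
      lemma₂ = solve-∀
    ⊗-identityˡ : ∀ X → 𝟙 ⊗ X ≡ X
    ⊗-identityˡ ⟨ a , b ⟩ = cong₂ ⟨_,_⟩ (lemma₁ a b) (lemma₂ K a b)
      where
      lemma₁ : ∀ a b → 1ℤ * a + 0ℤ * b ≡ a
      lemma₁ = solve-∀
      lemma₂ : ∀ k a b → 1ℤ * b + 0ℤ * a + k * (0ℤ * b) ≡ b
      lemma₂ = solve-∀
    ⊗-distribˡ : ∀ X Y Z → X ⊗ (Y ⊕ Z) ≡ X ⊗ Y ⊕ X ⊗ Z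
    ⊗-distribˡ ⟨ a , b ⟩ ⟨ c , d ⟩ ⟨ e , f ⟩ =
      cong₂ ⟨_,_⟩ (lemma₁ a b c d e f) (lemma₂ K a b c d e f)
      where
      lemma₁ : ∀ a b c d e f → a * (c + e) + b * (d + f) ≡ a * c + b * d + (a * e + b * f)
      lemma₁ = solve-∀
      lemma₂ : ∀ k a b c d e f → a * (d + f) + b * (c + e) + k * (b * (d + f))
                                 ≡ a * d + b * c + k * (b * d) + (a * f + b * e + k * (b * f))
      lemma₂ = solve-∀

  commutativeRing : CommutativeRing 0ℓ 0ℓ
  commutativeRing = record { isCommutativeRing = isCommutativeRing }

  open SemiringExp (CommutativeRing.semiring commutativeRing) public
    using (_^_; ^-homo-*; ^-assocʳ)
  open GroupProperties (CommutativeRing.+-group commutativeRing) public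
    using () renaming (∙-cancelˡ to ⊕-cancelˡ)

  ι⊗ : ∀ a x y → ι a ⊗ ⟨ x , y ⟩ ≡ ⟨ a * x , a * y ⟩
  ι⊗ a x y = cong₂ ⟨_,_⟩ (lemma₁ a x y) (lemma₂ K a x y)
    where
    lemma₁ : ∀ a x y → a * x + 0ℤ * y ≡ a * x
    lemma₁ = solve-∀
    lemma₂ : ∀ k a x y → a * y + 0ℤ * x + k * (0ℤ * y) ≡ a * y
    lemma₂ = solve-∀

  ι-⊗ : ∀ a b → ι (a * b) ≡ ι a ⊗ ι b
  ι-⊗ a b = sym (trans (ι⊗ a b 0ℤ) (cong ⟨ a * b ,_⟩ (ℤ.*-zeroʳ a)))

  ι-homomorphism : CommutativeRing.rawRing ℤ.+-*-commutativeRing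
                     -Raw-AlmostCommutative⟶ fromCommutativeRing commutativeRing
  ι-homomorphism = record
    { ⟦_⟧ = ι ; +-homo = λ _ _ → refl ; *-homo = ι-⊗ ; -‿homo = λ _ → refl
    ; 0-homo = refl ; 1-homo = refl }

  open RingSolver _ _ ι-homomorphism (λ a b → Maybe.map (cong ι) (dec⇒maybe (a ℤ.≟ b))) public
    using (solve; _:=_; con; _:+_; _:*_; _:-_; _:^_)

  -- Opaque so that the type checker never normalises closed expressions in t.
  opaque
    t : R
    t = ⟨ 0ℤ , 1ℤ ⟩

  opaque
    unfolding t

    t≡⟨0,1⟩ : t ≡ ⟨ 0ℤ , 1ℤ ⟩
    t≡⟨0,1⟩ = refl

    t⊗⟨a,b⟩ : ∀ a b → t ⊗ ⟨ a , b ⟩ ≡ ⟨ b , K * b + a ⟩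
    t⊗⟨a,b⟩ a b = cong₂ ⟨_,_⟩ (lemma₁ a b) (lemma₂ K a b)
      where
      lemma₁ : ∀ a b → 0ℤ * a + 1ℤ * b ≡ b
      lemma₁ = solve-∀
      lemma₂ : ∀ k a b → 0ℤ * b + 1ℤ * a + k * (1ℤ * b) ≡ k * b + a
      lemma₂ = solve-∀

    t⊗t≡ιK⊗t⊕𝟙 : t ⊗ t ≡ ι K ⊗ t ⊕ 𝟙
    t⊗t≡ιK⊗t⊕𝟙 = trans (t⊗⟨a,b⟩ 0ℤ 1ℤ) (cong₂ ⟨_,_⟩ (lemma₁ K) (lemma₂ K))
      where
      lemma₁ : ∀ k → 1ℤ ≡ k * 0ℤ + 0ℤ * 1ℤ + 1ℤ
      lemma₁ = solve-∀
      lemma₂ : ∀ k → k * 1ℤ + 0ℤ ≡ k * 1ℤ + 0ℤ * 0ℤ + k * (0ℤ * 1ℤ) + 0ℤ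
      lemma₂ = solve-∀

  t⊗[t⊖ιK]≡𝟙 : t ⊗ (t ⊕ ⊝ ι K) ≡ 𝟙
  t⊗[t⊖ιK]≡𝟙 = begin
    t ⊗ (t ⊕ ⊝ ι K)           ≡⟨ solve 2 (λ t k → t :* (t :- k) := t :* t :- k :* t) refl t (ι K) ⟩
    t ⊗ t ⊕ ⊝ (ι K ⊗ t)       ≡⟨ cong (_⊕ ⊝ (ι K ⊗ t)) t⊗t≡ιK⊗t⊕𝟙 ⟩
    ι K ⊗ t ⊕ 𝟙 ⊕ ⊝ (ι K ⊗ t) ≡⟨ solve 1 (λ x → x :+ con 1ℤ :- x := con 1ℤ) refl (ι K ⊗ t) ⟩
    𝟙                         ∎
    where open ≡-Reasoning

  ι[a*b]⊗X : ∀ a b X → ι (+ (a ℕ.* b)) ⊗ X ≡ ι (+ a) ⊗ (ι (+ b) ⊗ X)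
  ι[a*b]⊗X a b X = begin
    ι (+ (a ℕ.* b)) ⊗ X     ≡⟨ cong (λ c → ι c ⊗ X) (ℤ.pos-* a b) ⟩
    ι (+ a * + b) ⊗ X       ≡⟨ cong (_⊗ X) (ι-⊗ (+ a) (+ b)) ⟩
    ι (+ a) ⊗ ι (+ b) ⊗ X   ≡⟨ solve 3 (λ a b x → a :* b :* x := a :* (b :* x))
                                 refl (ι (+ a)) (ι (+ b)) X ⟩
    ι (+ a) ⊗ (ι (+ b) ⊗ X) ∎
    where open ≡-Reasoning

  ι-cancelˡ : ∀ a .{{_ : ℤ.NonZero a}} {X X′} → ι a ⊗ X ≡ ι a ⊗ X′ → X ≡ X′
  ι-cancelˡ a {⟨ x₁ , x₂ ⟩} {⟨ x₁′ , x₂′ ⟩} eq =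
    cong₂ ⟨_,_⟩ (ℤ.*-cancelˡ-≡ a x₁ x₁′ (cong R.c₀ eq′)) (ℤ.*-cancelˡ-≡ a x₂ x₂′ (cong R.c₁ eq′))
    where
    eq′ : ⟨ a * x₁ , a * x₂ ⟩ ≡ ⟨ a * x₁′ , a * x₂′ ⟩
    eq′ = trans (sym (ι⊗ a x₁ x₂)) (trans eq (ι⊗ a x₁′ x₂′))

  infix 4 _∣ᴿ_ _≡_[mod_]

  _∣ᴿ_ : ℤ → R → Set
  m ∣ᴿ X = ∃[ Y ] X ≡ ι m ⊗ Y

  _≡_[mod_] : R → R → ℤ → Set
  X ≡ X′ [mod m ] = ∃[ Y ] X ≡ X′ ⊕ ι m ⊗ Y

  module _ {m : ℤ} where

    ∣ᴿ-⊕ : ∀ {X X′} → m ∣ᴿ X → m ∣ᴿ X′ → m ∣ᴿ X ⊕ X′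
    ∣ᴿ-⊕ (Y , refl) (Y′ , refl) =
      Y ⊕ Y′ , solve 3 (λ m y y′ → m :* y :+ m :* y′ := m :* (y :+ y′)) refl (ι m) Y Y′

    ∣ᴿ-⊗ʳ : ∀ {X} → m ∣ᴿ X → ∀ Z → m ∣ᴿ X ⊗ Z
    ∣ᴿ-⊗ʳ (Y , refl) Z = Y ⊗ Z , solve 3 (λ m y z → m :* y :* z := m :* (y :* z)) refl (ι m) Y Z

    ∣ᴿ-⊗ˡ : ∀ {X} → m ∣ᴿ X → ∀ Z → m ∣ᴿ Z ⊗ X
    ∣ᴿ-⊗ˡ (Y , refl) Z = Z ⊗ Y , solve 3 (λ m y z → z :* (m :* y) := m :* (z :* y)) refl (ι m) Y Z

    ∣ᴿ-cancelʳ : ∀ {X X′} → m ∣ᴿ X ⊕ X′ → m ∣ᴿ X′ → m ∣ᴿ X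
    ∣ᴿ-cancelʳ {X} (Y , eq) (Y′ , refl) = Y ⊕ ⊝ Y′ , (begin
      X                           ≡⟨ solve 2 (λ x x′ → x := x :+ x′ :- x′) refl X (ι m ⊗ Y′) ⟩
      X ⊕ ι m ⊗ Y′ ⊕ ⊝ (ι m ⊗ Y′) ≡⟨ cong (_⊕ ⊝ (ι m ⊗ Y′)) eq ⟩
      ι m ⊗ Y ⊕ ⊝ (ι m ⊗ Y′)      ≡⟨ solve 3 (λ m y y′ → m :* y :- m :* y′ := m :* (y :- y′))
                                       refl (ι m) Y Y′ ⟩
      ι m ⊗ (Y ⊕ ⊝ Y′)            ∎)
      where open ≡-Reasoning

    ∣ᴿ⇒∣coefficients : ∀ {X} → m ∣ᴿ X → m ∣ R.c₀ X × m ∣ R.c₁ X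
    ∣ᴿ⇒∣coefficients (⟨ y₁ , y₂ ⟩ , refl) =
      divides y₁ (trans (cong R.c₀ (ι⊗ m y₁ y₂)) (ℤ.*-comm m y₁)) ,
      divides y₂ (trans (cong R.c₁ (ι⊗ m y₁ y₂)) (ℤ.*-comm m y₂))

    ∣coefficients⇒∣ᴿ : ∀ {x₁ x₂} → m ∣ x₁ → m ∣ x₂ → m ∣ᴿ ⟨ x₁ , x₂ ⟩
    ∣coefficients⇒∣ᴿ (divides y₁ refl) (divides y₂ refl) =
      ⟨ y₁ , y₂ ⟩ , sym (trans (ι⊗ m y₁ y₂) (cong₂ ⟨_,_⟩ (ℤ.*-comm m y₁) (ℤ.*-comm m y₂)))

  ∣ᴿ-trans : ∀ {a b X} → a ℕ.∣ b → + b ∣ᴿ X → + a ∣ᴿ X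
  ∣ᴿ-trans {a} (ℕ.divides c refl) (Y , refl) = ι (+ c) ⊗ Y , (begin
    ι (+ (c ℕ.* a)) ⊗ Y     ≡⟨ cong (λ n → ι (+ n) ⊗ Y) (ℕ.*-comm c a) ⟩
    ι (+ (a ℕ.* c)) ⊗ Y     ≡⟨ ι[a*b]⊗X a c Y ⟩
    ι (+ a) ⊗ (ι (+ c) ⊗ Y) ∎)
    where open ≡-Reasoning

  ∣⇒∣ᴿι : ∀ {a b} → a ℕ.∣ b → + a ∣ᴿ ι (+ b)
  ∣⇒∣ᴿι {b = b} a∣b = ∣ᴿ-trans a∣b (𝟙 , solve 1 (λ b → b := b :* con 1ℤ) refl (ι (+ b)))

  prime∣a*x : ∀ {q} a x → Prime q → + q ∣ + a * x → q ℕ.∣ a ⊎ + q ∣ x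
  prime∣a*x {q} a x q-prime q∣ax
    with euclidsLemma a ℤ.∣ x ∣ q-prime (subst (q ℕ.∣_) (ℤ.abs-* (+ a) x) (ℤ.∣⇒∣ᵤ q∣ax))
  ... | inj₁ q∣a = inj₁ q∣a
  ... | inj₂ q∣x = inj₂ (ℤ.∣ᵤ⇒∣ q∣x)

  euclid-ι⊗ : ∀ {q} a X → Prime q → + q ∣ᴿ ι (+ a) ⊗ X → q ℕ.∣ a ⊎ + q ∣ᴿ X
  euclid-ι⊗ {q} a ⟨ x₁ , x₂ ⟩ q-prime q∣aX
    with ∣ᴿ⇒∣coefficients (subst (+ q ∣ᴿ_) (ι⊗ (+ a) x₁ x₂) q∣aX)
  ... | q∣ax₁ , q∣ax₂ with prime∣a*x a x₁ q-prime q∣ax₁ | prime∣a*x a x₂ q-prime q∣ax₂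
  ...   | inj₁ q∣a  | _         = inj₁ q∣a
  ...   | inj₂ _    | inj₁ q∣a  = inj₁ q∣a
  ...   | inj₂ q∣x₁ | inj₂ q∣x₂ = inj₂ (∣coefficients⇒∣ᴿ q∣x₁ q∣x₂)

  ≡[mod*]⇒≡[mod] : ∀ {X X′} a b → X ≡ X′ [mod + (a ℕ.* b) ] → X ≡ X′ [mod + a ]
  ≡[mod*]⇒≡[mod] {X′ = X′} a b (Y , eq) = ι (+ b) ⊗ Y , trans eq (cong (X′ ⊕_) (ι[a*b]⊗X a b Y))

  module _ {m : ℤ} where

    ≡[mod]⇒c₁ : ∀ {X X′} → X ≡ X′ [mod m ] → ∃[ q ] R.c₁ X ≡ R.c₁ X′ + m * q
    ≡[mod]⇒c₁ {X′ = X′@(⟨ _ , _ ⟩)} (⟨ y₁ , y₂ ⟩ , refl) =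
      y₂ , cong (λ Z → R.c₁ (X′ ⊕ Z)) (ι⊗ m y₁ y₂)

    ≡𝟙⇒⊗≡ : ∀ {X} → X ≡ 𝟙 [mod m ] → ∀ Y → Y ⊗ X ≡ Y [mod m ]
    ≡𝟙⇒⊗≡ (A , refl) Y =
      Y ⊗ A , solve 3 (λ y m a → y :* (con 1ℤ :+ m :* a) := y :+ m :* (y :* a)) refl Y (ι m) A

    ≡𝟙-⊗ : ∀ {X X′} → X ≡ 𝟙 [mod m ] → X′ ≡ 𝟙 [mod m ] → X ⊗ X′ ≡ 𝟙 [mod m ]
    ≡𝟙-⊗ (A , refl) (B , refl) = A ⊕ B ⊕ ι m ⊗ A ⊗ B ,
      solve 3 (λ m a b → (con 1ℤ :+ m :* a) :* (con 1ℤ :+ m :* b)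
                         := con 1ℤ :+ m :* (a :+ b :+ m :* a :* b)) refl (ι m) A B

    ≡𝟙-^ : ∀ {X} → X ≡ 𝟙 [mod m ] → ∀ n → X ^ n ≡ 𝟙 [mod m ]
    ≡𝟙-^ _ ℕ.zero = 𝟘 , solve 1 (λ m → con 1ℤ := con 1ℤ :+ m :* con 0ℤ) refl (ι m)
    ≡𝟙-^ X≡𝟙 (ℕ.suc n) = ≡𝟙-⊗ X≡𝟙 (≡𝟙-^ X≡𝟙 n)

    ≡𝟙-cancelʳ : ∀ {X X′} → X ⊗ X′ ≡ 𝟙 [mod m ] → X′ ≡ 𝟙 [mod m ] → X ≡ 𝟙 [mod m ]
    ≡𝟙-cancelʳ {X} (A , eq) (B , refl) = A ⊕ ⊝ (X ⊗ B) , (begin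
      X
        ≡⟨ solve 3 (λ x m b → x := x :* (con 1ℤ :+ m :* b) :- m :* (x :* b)) refl X (ι m) B ⟩
      X ⊗ (𝟙 ⊕ ι m ⊗ B) ⊕ ⊝ (ι m ⊗ (X ⊗ B))
        ≡⟨ cong (_⊕ ⊝ (ι m ⊗ (X ⊗ B))) eq ⟩
      𝟙 ⊕ ι m ⊗ A ⊕ ⊝ (ι m ⊗ (X ⊗ B))
        ≡⟨ solve 3 (λ m a c → con 1ℤ :+ m :* a :- m :* c := con 1ℤ :+ m :* (a :- c))
             refl (ι m) A (X ⊗ B) ⟩
      𝟙 ⊕ ι m ⊗ (A ⊕ ⊝ (X ⊗ B))
        ∎)
      where open ≡-Reasoning

    ^%-≡𝟙 : ∀ {X n s} .{{_ : ℕ.NonZero n}} →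
            X ^ n ≡ 𝟙 [mod m ] → X ^ s ≡ 𝟙 [mod m ] → X ^ (s ℕ.% n) ≡ 𝟙 [mod m ]
    ^%-≡𝟙 {X} {n} {s} Xⁿ≡𝟙 Xˢ≡𝟙 =
      ≡𝟙-cancelʳ (subst (λ Z → Z ≡ 𝟙 [mod m ]) Xˢ≡ Xˢ≡𝟙) (≡𝟙-^ Xⁿ≡𝟙 (s ℕ./ n))
      where
      open ≡-Reasoning
      Xˢ≡ : X ^ s ≡ X ^ (s ℕ.% n) ⊗ (X ^ n) ^ (s ℕ./ n)
      Xˢ≡ = begin
        X ^ s                                  ≡⟨ cong (X ^_) (ℕ.m≡m%n+[m/n]*n s n) ⟩
        X ^ (s ℕ.% n ℕ.+ s ℕ./ n ℕ.* n)        ≡⟨ ^-homo-* X (s ℕ.% n) _ ⟩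
        X ^ (s ℕ.% n) ⊗ X ^ (s ℕ./ n ℕ.* n)    ≡⟨ cong (λ k → X ^ (s ℕ.% n) ⊗ X ^ k)
                                                       (ℕ.*-comm (s ℕ./ n) n) ⟩
        X ^ (s ℕ.% n) ⊗ X ^ (n ℕ.* (s ℕ./ n))  ≡⟨ cong (X ^ (s ℕ.% n) ⊗_)
                                                       (sym (^-assocʳ X n (s ℕ./ n))) ⟩
        X ^ (s ℕ.% n) ⊗ (X ^ n) ^ (s ℕ./ n)    ∎

    unit⊗X≡unit⇒X≡𝟙 : ∀ {U U′ X} → U ⊗ U′ ≡ 𝟙 → U ⊗ X ≡ U [mod m ] → X ≡ 𝟙 [mod m ]
    unit⊗X≡unit⇒X≡𝟙 {U} {U′} {X} UU′≡𝟙 (A , eq) = U′ ⊗ A , (begin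
      X                       ≡⟨ solve 1 (λ x → x := con 1ℤ :* x) refl X ⟩
      𝟙 ⊗ X                   ≡⟨ cong (_⊗ X) (sym UU′≡𝟙) ⟩
      U ⊗ U′ ⊗ X              ≡⟨ solve 3 (λ u u′ x → u :* u′ :* x := u′ :* (u :* x)) refl U U′ X ⟩
      U′ ⊗ (U ⊗ X)            ≡⟨ cong (U′ ⊗_) eq ⟩
      U′ ⊗ (U ⊕ ι m ⊗ A)      ≡⟨ solve 4 (λ u u′ m a → u′ :* (u :+ m :* a) := u :* u′ :+ m :* (u′ :* a))
                                   refl U U′ (ι m) A ⟩
      U ⊗ U′ ⊕ ι m ⊗ (U′ ⊗ A) ≡⟨ cong (_⊕ ι m ⊗ (U′ ⊗ A)) UU′≡𝟙 ⟩
      𝟙 ⊕ ι m ⊗ (U′ ⊗ A)      ∎)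
      where open ≡-Reasoning

  binomial-tail : ℕ.ℕ → R → R → R
  binomial-tail n X S = ι (+ (n ℕ.C 2)) ⊕ ι (+ (n ℕ.C 3)) ⊗ X ⊕ X ⊗ X ⊗ S

  binomial : ∀ X n → ∃[ S ] (𝟙 ⊕ X) ^ n ≡ 𝟙 ⊕ ι (+ n) ⊗ X ⊕ X ⊗ X ⊗ binomial-tail n X S
  binomial X ℕ.zero = 𝟘 , solve 1 (λ x → con 1ℤ := con 1ℤ :+ con 0ℤ :* x :+ x :* x :*
                                        (con 0ℤ :+ con 0ℤ :* x :+ x :* x :* con 0ℤ)) refl X
  binomial X (ℕ.suc n) with binomial X n
  ... | S , eq = c₃ ⊕ (𝟙 ⊕ X) ⊗ S , (begin
    (𝟙 ⊕ X) ⊗ (𝟙 ⊕ X) ^ n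
      ≡⟨ cong ((𝟙 ⊕ X) ⊗_) eq ⟩
    (𝟙 ⊕ X) ⊗ (𝟙 ⊕ c₁ ⊗ X ⊕ X ⊗ X ⊗ (c₂ ⊕ c₃ ⊗ X ⊕ X ⊗ X ⊗ S))
      ≡⟨ solve 5 (λ x s c₁ c₂ c₃ →
           (con 1ℤ :+ x) :* (con 1ℤ :+ c₁ :* x :+ x :* x :* (c₂ :+ c₃ :* x :+ x :* x :* s))
           := con 1ℤ :+ (con 1ℤ :+ c₁) :* x :+ x :* x :*
                ((c₁ :+ c₂) :+ (c₂ :+ c₃) :* x :+ x :* x :* (c₃ :+ (con 1ℤ :+ x) :* s)))
         refl X S c₁ c₂ c₃ ⟩
    𝟙 ⊕ (𝟙 ⊕ c₁) ⊗ X ⊕ X ⊗ X ⊗ ((c₁ ⊕ c₂) ⊕ (c₂ ⊕ c₃) ⊗ X ⊕ X ⊗ X ⊗ (c₃ ⊕ (𝟙 ⊕ X) ⊗ S))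
      ≡⟨ cong₂ (λ a b → 𝟙 ⊕ ι (+ ℕ.suc n) ⊗ X ⊕ X ⊗ X ⊗
                  (ι (+ a) ⊕ ι (+ b) ⊗ X ⊕ X ⊗ X ⊗ (c₃ ⊕ (𝟙 ⊕ X) ⊗ S)))
               pascal₂ (ℕ.nCk+nC[k+1]≡[n+1]C[k+1] n 2) ⟩
    𝟙 ⊕ ι (+ ℕ.suc n) ⊗ X ⊕ X ⊗ X ⊗ binomial-tail (ℕ.suc n) X (c₃ ⊕ (𝟙 ⊕ X) ⊗ S)
      ∎)
    where
    open ≡-Reasoning
    c₁ c₂ c₃ : R
    c₁ = ι (+ n)
    c₂ = ι (+ (n ℕ.C 2))
    c₃ = ι (+ (n ℕ.C 3))
    pascal₂ : n ℕ.+ n ℕ.C 2 ≡ ℕ.suc n ℕ.C 2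
    pascal₂ = trans (cong (ℕ._+ n ℕ.C 2) (sym (ℕ.nC1≡n n))) (ℕ.nCk+nC[k+1]≡[n+1]C[k+1] n 1)

open import Data.Empty using (⊥-elim)
open import Data.List using ([]; _∷_)
open import Data.List.Relation.Unary.All using (All; []; _∷_)
open import Data.Nat
  using (ℕ; zero; suc; _+_; _*_; _%_; _/_; _≤_; _<_; NonZero; >-nonZero; >-nonZero⁻¹)
open import Data.Nat.Combinatorics using (_C_; nC1≡n; nCk+nC[k+1]≡[n+1]C[k+1])
open import Data.Nat.DivMod
  using (m≡m%n+[m/n]*n; %-distribˡ-+; %-distribˡ-*; %-remove-+ʳ; m%n<n; m%n%n≡m%n; m∣n⇒o%n%m≡o%m)
open import Data.Nat.Divisibility
  using (_∣_; divides; ∣-trans; ∣⇒≤; m∣m*n; ∣m⇒∣m*n; ∣n⇒∣m*n; ∣m+n∣m⇒∣n; ∣1⇒≡1; *-monoʳ-∣;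
         %-presˡ-∣; m%n≡0⇒n∣m)
open import Data.Nat.ListAction using (product)
open import Data.Nat.Primality using (¬prime[0]; ¬prime[1]; productOfPrimes≢0)
open import Data.Nat.Primality.Factorisation using (factorise; PrimeFactorisation)
open import Data.Nat.Properties using (_≟_; allUpTo?; *-comm; *-assoc; *-distribˡ-+; m*n≢0)
open import Relation.Nullary using (¬_)
open import Relation.Nullary.Decidable using (Dec; map′; toWitness; _×-dec_; _⊎-dec_; _→-dec_)
open import Defs

%-cong-*+ : ∀ {a a′ b b′ c c′} m .{{_ : NonZero m}} → a % m ≡ a′ % m → b % m ≡ b′ % m →
            c % m ≡ c′ % m → (a * b + c) % m ≡ (a′ * b′ + c′) % m
%-cong-*+ {a} {a′} {b} {b′} {c} {c′} m a≡a′ b≡b′ c≡c′ =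
  trans (reduce a b c)
        (trans (cong₂ (λ x y → (x + y) % m) (cong₂ (λ x y → x * y % m) a≡a′ b≡b′) c≡c′)
               (sym (reduce a′ b′ c′)))
  where
  reduce : ∀ x y z → (x * y + z) % m ≡ ((x % m) * (y % m) % m + z % m) % m
  reduce x y z = trans (%-distribˡ-+ (x * y) z m) (cong (λ w → (w + z % m) % m) (%-distribˡ-* x y m))

KFib-%-cong : ∀ {K K′} m .{{_ : NonZero m}} → K % m ≡ K′ % m → ∀ n → KFib K n % m ≡ KFib K′ n % m
KFib-%-cong m K≡K′ zero = refl
KFib-%-cong m K≡K′ (suc zero) = refl
KFib-%-cong m K≡K′ (suc (suc n)) =
  %-cong-*+ m K≡K′ (KFib-%-cong m K≡K′ (suc n)) (KFib-%-cong m K≡K′ n)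

%≡%⇒≡+*q : ∀ {a b m} .{{_ : NonZero m}} → a % m ≡ b % m → ∃[ q ] + a ≡ + b ℤ.+ + m ℤ.* q
%≡%⇒≡+*q {a} {b} {m} a≡b = q , (begin
  + a                                         ≡⟨ +-divMod a ⟩
  + (a % m) ℤ.+ + (a / m) ℤ.* + m             ≡⟨ cong (λ r → + r ℤ.+ + (a / m) ℤ.* + m) a≡b ⟩
  + (b % m) ℤ.+ + (a / m) ℤ.* + m             ≡⟨ shift (+ (b % m)) (+ (a / m)) (+ (b / m)) (+ m) ⟩
  + (b % m) ℤ.+ + (b / m) ℤ.* + m ℤ.+ + m ℤ.* q ≡⟨ cong (ℤ._+ + m ℤ.* q) (sym (+-divMod b)) ⟩
  + b ℤ.+ + m ℤ.* q                           ∎)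
  where
  open ≡-Reasoning
  q : ℤ
  q = + (a / m) ℤ.- + (b / m)
  +-divMod : ∀ n → + n ≡ + (n % m) ℤ.+ + (n / m) ℤ.* + m
  +-divMod n = trans (cong +_ (m≡m%n+[m/n]*n n m))
                     (trans (ℤ.pos-+ (n % m) _) (cong (λ x → + (n % m) ℤ.+ x) (ℤ.pos-* (n / m) m)))
  shift : ∀ r x y m → r ℤ.+ x ℤ.* m ≡ r ℤ.+ y ℤ.* m ℤ.+ m ℤ.* (x ℤ.- y)
  shift = solve-∀

≡+*q⇒%≡% : ∀ {a b m} .{{_ : NonZero m}} q → + a ≡ + b ℤ.+ + m ℤ.* q → a % m ≡ b % m
≡+*q⇒%≡% {m = m} (+ n) eq = ≡+*n⇒%≡% eq
  where
  ≡+*n⇒%≡% : ∀ {a b n} → + a ≡ + b ℤ.+ + m ℤ.* + n → a % m ≡ b % m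
  ≡+*n⇒%≡% {a} {b} {n} eq = begin
    a % m           ≡⟨ cong (_% m) (ℤ.+-injective (trans eq (sym +[b+m*n]))) ⟩
    (b + m * n) % m ≡⟨ %-remove-+ʳ b (m∣m*n n) ⟩
    b % m           ∎
    where
    open ≡-Reasoning
    +[b+m*n] : + (b + m * n) ≡ + b ℤ.+ + m ℤ.* + n
    +[b+m*n] = trans (ℤ.pos-+ b (m * n)) (cong (λ x → + b ℤ.+ x) (ℤ.pos-* m n))
≡+*q⇒%≡% {a} {b} {m} -[1+ n ] eq = sym (≡+*q⇒%≡% (+ suc n) (flip (+ a) (+ b) (+ m) (+ suc n) eq))
  where
  flip : ∀ a b m x → a ≡ b ℤ.+ m ℤ.* (ℤ.- x) → b ≡ a ℤ.+ m ℤ.* x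
  flip a b m x eq = trans (lemma b m x) (cong (ℤ._+ m ℤ.* x) (sym eq))
    where
    lemma : ∀ b m x → b ≡ b ℤ.+ m ℤ.* (ℤ.- x) ℤ.+ m ℤ.* x
    lemma = solve-∀

2*[1+n]C2 : ∀ n → 2 * (suc n C 2) ≡ suc n * n
2*[1+n]C2 zero = refl
2*[1+n]C2 (suc n) = begin
  2 * (suc (suc n) C 2)         ≡⟨ cong (2 *_) (sym (nCk+nC[k+1]≡[n+1]C[k+1] (suc n) 1)) ⟩
  2 * (suc n C 1 + suc n C 2)   ≡⟨ cong (λ x → 2 * (x + suc n C 2)) (nC1≡n (suc n)) ⟩
  2 * (suc n + suc n C 2)       ≡⟨ *-distribˡ-+ 2 (suc n) (suc n C 2) ⟩
  2 * suc n + 2 * (suc n C 2)   ≡⟨ cong (λ x → 2 * suc n + x) (2*[1+n]C2 n) ⟩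
  2 * suc n + suc n * n         ≡⟨ lemma n ⟩
  suc (suc n) * suc n           ∎
  where
  open ≡-Reasoning
  lemma : ∀ n → 2 * (1 + n) + (1 + n) * n ≡ (2 + n) * (1 + n)
  lemma = ℕ.solve-∀

6*[2+n]C3 : ∀ n → 6 * (suc (suc n) C 3) ≡ suc (suc n) * suc n * n
6*[2+n]C3 zero = refl
6*[2+n]C3 (suc n) = begin
  6 * (3+n C 3)                                   ≡⟨ cong (6 *_) (sym (nCk+nC[k+1]≡[n+1]C[k+1] 2+n 2)) ⟩
  6 * (2+n C 2 + 2+n C 3)                         ≡⟨ lemma₁ (2+n C 2) (2+n C 3) ⟩
  3 * (2 * (2+n C 2)) + 6 * (2+n C 3)             ≡⟨ cong₂ (λ x y → 3 * x + y) (2*[1+n]C2 (suc n))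
                                                           (6*[2+n]C3 n) ⟩
  3 * (2+n * suc n) + 2+n * suc n * n             ≡⟨ lemma₂ n ⟩
  3+n * 2+n * suc n                               ∎
  where
  open ≡-Reasoning
  2+n 3+n : ℕ
  2+n = suc (suc n)
  3+n = suc 2+n
  lemma₁ : ∀ a b → 6 * (a + b) ≡ 3 * (2 * a) + 6 * b
  lemma₁ = ℕ.solve-∀
  lemma₂ : ∀ n → 3 * ((2 + n) * (1 + n)) + (2 + n) * (1 + n) * n ≡ (3 + n) * (2 + n) * (1 + n)
  lemma₂ = ℕ.solve-∀

prime∤6⇒∣pC2 : ∀ {p} → Prime p → ¬ p ∣ 6 → p ∣ p C 2
prime∤6⇒∣pC2 {zero} p-prime _ = ⊥-elim (¬prime[0] p-prime)
prime∤6⇒∣pC2 {suc n} p-prime p∤6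
  with euclidsLemma 2 (suc n C 2) p-prime (subst (suc n ∣_) (sym (2*[1+n]C2 n)) (m∣m*n n))
... | inj₁ p∣2   = ⊥-elim (p∤6 (∣-trans p∣2 (divides 3 refl)))
... | inj₂ p∣pC2 = p∣pC2

prime∤6⇒∣pC3 : ∀ {p} → Prime p → ¬ p ∣ 6 → p ∣ p C 3
prime∤6⇒∣pC3 {zero} p-prime _ = ⊥-elim (¬prime[0] p-prime)
prime∤6⇒∣pC3 {suc zero} p-prime _ = ⊥-elim (¬prime[1] p-prime)
prime∤6⇒∣pC3 {suc (suc n)} p-prime p∤6
  with euclidsLemma 6 (suc (suc n) C 3) p-prime
         (subst (suc (suc n) ∣_) (sym (trans (6*[2+n]C3 n) (*-assoc (suc (suc n)) (suc n) n)))
                (m∣m*n (suc n * n)))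
... | inj₁ p∣6   = ⊥-elim (p∤6 p∣6)
... | inj₂ p∣pC3 = p∣pC3

record Restarts (K m : ℕ) .{{_ : NonZero m}} (s : ℕ) : Set where
  constructor restarts
  field
    F[s]≡0   : KFib K s % m ≡ 0 % m
    F[1+s]≡1 : KFib K (suc s) % m ≡ 1 % m

restarts? : ∀ K m .{{_ : NonZero m}} s → Dec (Restarts K m s)
restarts? K m s = map′ (λ (F≡0 , F′≡1) → restarts F≡0 F′≡1) (λ (restarts F≡0 F′≡1) → F≡0 , F′≡1)
                       (KFib K s % m ≟ 0 % m ×-dec KFib K (suc s) % m ≟ 1 % m)

Restarts-%-cong : ∀ {K K′ m} .{{_ : NonZero m}} s → K % m ≡ K′ % m → Restarts K m s → Restarts K′ m s
Restarts-%-cong {m = m} s K≡K′ (restarts F≡0 F′≡1) =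
  restarts (trans (sym (KFib-%-cong m K≡K′ s)) F≡0) (trans (sym (KFib-%-cong m K≡K′ (suc s))) F′≡1)

restarts-mod-24 : ∀ {k} → k < 24 → k % 6 ≡ 1 ⊎ k % 6 ≡ 5 →
                  Restarts k 24 24 × (∀ {r} → r < 24 → Restarts k 24 r → r ≡ 0)
restarts-mod-24 = toWitness {a? = allUpTo? (λ k → (k % 6 ≟ 1 ⊎-dec k % 6 ≟ 5) →-dec
                    (restarts? k 24 24 ×-dec allUpTo? (λ r → restarts? k 24 r →-dec r ≟ 0) 24)) 24} _

module KFibonacci (K : ℕ) where

  open QuadraticRing (+ K) public

  t^[1+n]≡⟨Fₙ,Fₙ₊₁⟩ : ∀ n → t ^ suc n ≡ ⟨ + KFib K n , + KFib K (suc n) ⟩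
  t^[1+n]≡⟨Fₙ,Fₙ₊₁⟩ zero = trans (solve 1 (λ t → t :* con 1ℤ := t) refl t) t≡⟨0,1⟩
  t^[1+n]≡⟨Fₙ,Fₙ₊₁⟩ (suc n) = begin
    t ⊗ t ^ suc n
      ≡⟨ cong (t ⊗_) (t^[1+n]≡⟨Fₙ,Fₙ₊₁⟩ n) ⟩
    t ⊗ ⟨ + KFib K n , + KFib K (suc n) ⟩
      ≡⟨ t⊗⟨a,b⟩ _ _ ⟩
    ⟨ + KFib K (suc n) , + K ℤ.* + KFib K (suc n) ℤ.+ + KFib K n ⟩
      ≡⟨ cong ⟨ + KFib K (suc n) ,_⟩ (sym +[K*b+a]) ⟩
    ⟨ + KFib K (suc n) , + KFib K (suc (suc n)) ⟩
      ∎
    where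
    open ≡-Reasoning
    +[K*b+a] : + (K * KFib K (suc n) + KFib K n) ≡ + K ℤ.* + KFib K (suc n) ℤ.+ + KFib K n
    +[K*b+a] = trans (ℤ.pos-+ (K * KFib K (suc n)) _) (cong (ℤ._+ + KFib K n) (ℤ.pos-* K _))

  c₁[t^n]≡F : ∀ n → R.c₁ (t ^ n) ≡ + KFib K n
  c₁[t^n]≡F zero = refl
  c₁[t^n]≡F (suc n) = cong R.c₁ (t^[1+n]≡⟨Fₙ,Fₙ₊₁⟩ n)

  module _ {m : ℕ} .{{_ : NonZero m}} where

    period⇒restarts : ∀ s → (∀ n → KFib K (n + s) % m ≡ KFib K n % m) → Restarts K m s
    period⇒restarts s period = restarts (period 0) (period 1)

    restarts⇒t^≡𝟙 : ∀ s → Restarts K m s → t ^ s ≡ 𝟙 [mod + m ]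
    restarts⇒t^≡𝟙 s (restarts F≡0 F′≡1) with %≡%⇒≡+*q F≡0 | %≡%⇒≡+*q F′≡1
    ... | q₀ , eq₀ | q₁ , eq₁ =
      unit⊗X≡unit⇒X≡𝟙 {U′ = t ⊕ ⊝ ι (+ K)} t⊗[t⊖ιK]≡𝟙 (⟨ q₀ , q₁ ⟩ , (begin
        t ^ suc s                                 ≡⟨ t^[1+n]≡⟨Fₙ,Fₙ₊₁⟩ s ⟩
        ⟨ + KFib K s , + KFib K (suc s) ⟩         ≡⟨ cong₂ ⟨_,_⟩ eq₀ eq₁ ⟩
        ⟨ 0ℤ ℤ.+ + m ℤ.* q₀ , 1ℤ ℤ.+ + m ℤ.* q₁ ⟩ ≡⟨ cong (⟨ 0ℤ , 1ℤ ⟩ ⊕_) (sym (ι⊗ (+ m) q₀ q₁)) ⟩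
        ⟨ 0ℤ , 1ℤ ⟩ ⊕ ι (+ m) ⊗ ⟨ q₀ , q₁ ⟩       ≡⟨ cong (_⊕ ι (+ m) ⊗ ⟨ q₀ , q₁ ⟩) (sym t≡⟨0,1⟩) ⟩
        t ⊕ ι (+ m) ⊗ ⟨ q₀ , q₁ ⟩                 ∎))
      where open ≡-Reasoning

    t^≡𝟙⇒period : ∀ s → t ^ s ≡ 𝟙 [mod + m ] → ∀ n → KFib K (n + s) % m ≡ KFib K n % m
    t^≡𝟙⇒period s t^s≡𝟙 n with ≡[mod]⇒c₁ (≡𝟙⇒⊗≡ t^s≡𝟙 (t ^ n))
    ... | q , eq = ≡+*q⇒%≡% q (begin
      + KFib K (n + s)           ≡⟨ sym (c₁[t^n]≡F (n + s)) ⟩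
      R.c₁ (t ^ (n + s))         ≡⟨ cong R.c₁ (^-homo-* t n s) ⟩
      R.c₁ (t ^ n ⊗ t ^ s)       ≡⟨ eq ⟩
      R.c₁ (t ^ n) ℤ.+ + m ℤ.* q ≡⟨ cong (ℤ._+ + m ℤ.* q) (c₁[t^n]≡F n) ⟩
      + KFib K n ℤ.+ + m ℤ.* q   ∎)
      where open ≡-Reasoning

  order≡m⇒isPisano : ∀ m .{{_ : NonZero m}} →
    t ^ m ≡ 𝟙 [mod + m ] → (∀ s → t ^ s ≡ 𝟙 [mod + m ] → m ∣ s) → IsPisano K m m
  order≡m⇒isPisano m t^m≡𝟙 m∣returns =
    (>-nonZero⁻¹ m , t^≡𝟙⇒period m t^m≡𝟙) ,
    λ s (1≤s , period) →
      ∣⇒≤ {{>-nonZero 1≤s}} (m∣returns s (restarts⇒t^≡𝟙 s (period⇒restarts s period)))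

  D : ℕ
  D = K * K + 4

  V E : R
  V = t ⊗ (ι (+ K) ⊗ t ⊕ ι (+ 2))
  E = ι (+ K) ⊗ V

  c₀[V]≡K : R.c₀ V ≡ + K
  c₀[V]≡K = begin
    R.c₀ V
      ≡⟨ cong (λ x → R.c₀ (t ⊗ (ι (+ K) ⊗ x ⊕ ι (+ 2)))) t≡⟨0,1⟩ ⟩
    R.c₀ (t ⊗ (ι (+ K) ⊗ ⟨ 0ℤ , 1ℤ ⟩ ⊕ ι (+ 2)))
      ≡⟨ cong (λ x → R.c₀ (t ⊗ (x ⊕ ι (+ 2)))) (ι⊗ (+ K) 0ℤ 1ℤ) ⟩
    R.c₀ (t ⊗ ⟨ + K ℤ.* 0ℤ ℤ.+ + 2 , + K ℤ.* 1ℤ ℤ.+ 0ℤ ⟩)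
      ≡⟨ cong R.c₀ (t⊗⟨a,b⟩ _ _) ⟩
    + K ℤ.* 1ℤ ℤ.+ 0ℤ
      ≡⟨ trans (ℤ.+-identityʳ _) (ℤ.*-identityʳ (+ K)) ⟩
    + K
      ∎
    where open ≡-Reasoning

  t⁴≡𝟙⊕E : t ^ 4 ≡ 𝟙 ⊕ E
  t⁴≡𝟙⊕E = begin
    t ^ 4                                 ≡⟨ solve 1 (λ t → t :^ 4 := t :* t :* (t :* t)) refl t ⟩
    t ⊗ t ⊗ (t ⊗ t)                       ≡⟨ cong₂ _⊗_ t⊗t≡ιK⊗t⊕𝟙 t⊗t≡ιK⊗t⊕𝟙 ⟩
    (ι (+ K) ⊗ t ⊕ 𝟙) ⊗ (ι (+ K) ⊗ t ⊕ 𝟙) ≡⟨ solve 2 (λ k t → (k :* t :+ con 1ℤ) :* (k :* t :+ con 1ℤ)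
                                                := con 1ℤ :+ k :* (t :* (k :* t :+ con (+ 2))))
                                                refl (ι (+ K)) t ⟩
    𝟙 ⊕ E                                 ∎
    where open ≡-Reasoning

  D∣ᴿE⊗E : + D ∣ᴿ E ⊗ E
  D∣ᴿE⊗E = κ ⊗ κ ⊗ (t ⊗ t) ⊗ (t ⊗ t) , (begin
    E ⊗ E
      ≡⟨ solve 2 (λ k t → k :* (t :* (k :* t :+ con (+ 2))) :* (k :* (t :* (k :* t :+ con (+ 2))))
                          := k :* k :* (t :* t) :*
                               (k :* k :* (t :* t) :+ con (+ 4) :* (k :* t :+ con 1ℤ)))
           refl κ t ⟩
    κ ⊗ κ ⊗ (t ⊗ t) ⊗ (κ ⊗ κ ⊗ (t ⊗ t) ⊕ ι (+ 4) ⊗ (κ ⊗ t ⊕ 𝟙))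
      ≡⟨ cong (λ x → κ ⊗ κ ⊗ (t ⊗ t) ⊗ (κ ⊗ κ ⊗ (t ⊗ t) ⊕ ι (+ 4) ⊗ x)) (sym t⊗t≡ιK⊗t⊕𝟙) ⟩
    κ ⊗ κ ⊗ (t ⊗ t) ⊗ (κ ⊗ κ ⊗ (t ⊗ t) ⊕ ι (+ 4) ⊗ (t ⊗ t))
      ≡⟨ solve 3 (λ k t f → k :* k :* (t :* t) :* (k :* k :* (t :* t) :+ f :* (t :* t))
                            := (k :* k :+ f) :* (k :* k :* (t :* t) :* (t :* t)))
           refl κ t (ι (+ 4)) ⟩
    (κ ⊗ κ ⊕ ι (+ 4)) ⊗ (κ ⊗ κ ⊗ (t ⊗ t) ⊗ (t ⊗ t))
      ≡⟨ cong (_⊗ (κ ⊗ κ ⊗ (t ⊗ t) ⊗ (t ⊗ t))) (sym ιD≡κ⊗κ⊕4) ⟩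
    ι (+ D) ⊗ (κ ⊗ κ ⊗ (t ⊗ t) ⊗ (t ⊗ t))
      ∎)
    where
    open ≡-Reasoning
    κ : R
    κ = ι (+ K)
    ιD≡κ⊗κ⊕4 : ι (+ D) ≡ κ ⊗ κ ⊕ ι (+ 4)
    ιD≡κ⊗κ⊕4 = trans (cong ι (trans (ℤ.pos-+ (K * K) 4) (cong (ℤ._+ + 4) (ℤ.pos-* K K))))
                     (cong (_⊕ ι (+ 4)) (ι-⊗ (+ K) (+ K)))

  t^[4j]-expansion : ∀ j → ∃[ H ] t ^ (4 * j) ≡ 𝟙 ⊕ ι (+ j) ⊗ E ⊕ ι (+ D) ⊗ H
  t^[4j]-expansion j = F ⊗ tail , (begin
    t ^ (4 * j)                          ≡⟨ sym (^-assocʳ t 4 j) ⟩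
    (t ^ 4) ^ j                          ≡⟨ cong (_^ j) t⁴≡𝟙⊕E ⟩
    (𝟙 ⊕ E) ^ j                          ≡⟨ proj₂ (binomial E j) ⟩
    𝟙 ⊕ ι (+ j) ⊗ E ⊕ E ⊗ E ⊗ tail       ≡⟨ cong (λ x → 𝟙 ⊕ ι (+ j) ⊗ E ⊕ x ⊗ tail) (proj₂ D∣ᴿE⊗E) ⟩
    𝟙 ⊕ ι (+ j) ⊗ E ⊕ ι (+ D) ⊗ F ⊗ tail ≡⟨ cong (𝟙 ⊕ ι (+ j) ⊗ E ⊕_)
                                               (solve 3 (λ d f b → d :* f :* b := d :* (f :* b))
                                                        refl (ι (+ D)) F tail) ⟩
    𝟙 ⊕ ι (+ j) ⊗ E ⊕ ι (+ D) ⊗ (F ⊗ tail) ∎)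
    where
    open ≡-Reasoning
    F tail : R
    F = proj₁ D∣ᴿE⊗E
    tail = binomial-tail j E (proj₁ (binomial E j))

  D∣ᴿ[t^4j⊖𝟙]² : ∀ j {W} → t ^ (4 * j) ≡ 𝟙 ⊕ W → + D ∣ᴿ W ⊗ W
  D∣ᴿ[t^4j⊖𝟙]² j {W} t^4j≡𝟙⊕W = subst (+ D ∣ᴿ_) (sym W⊗W≡)
    (∣ᴿ-⊕ (∣ᴿ-⊗ˡ D∣ᴿE⊗E (ι (+ j) ⊗ ι (+ j))) (ι (+ 2) ⊗ ι (+ j) ⊗ E ⊗ H ⊕ ι (+ D) ⊗ H ⊗ H , refl))
    where
    H : R
    H = proj₁ (t^[4j]-expansion j)
    W≡ : W ≡ ι (+ j) ⊗ E ⊕ ι (+ D) ⊗ H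
    W≡ = ⊕-cancelˡ 𝟙 W _ (trans (sym t^4j≡𝟙⊕W) (trans (proj₂ (t^[4j]-expansion j))
           (solve 3 (λ a b c → a :+ b :+ c := a :+ (b :+ c)) refl 𝟙 (ι (+ j) ⊗ E) (ι (+ D) ⊗ H))))
    W⊗W≡ : W ⊗ W ≡ ι (+ j) ⊗ ι (+ j) ⊗ (E ⊗ E) ⊕ ι (+ D) ⊗ (ι (+ 2) ⊗ ι (+ j) ⊗ E ⊗ H ⊕ ι (+ D) ⊗ H ⊗ H)
    W⊗W≡ = trans (cong (λ x → x ⊗ x) W≡)
             (solve 4 (λ j e d h → (j :* e :+ d :* h) :* (j :* e :+ d :* h)
                                   := j :* j :* (e :* e)
                                      :+ d :* (con (+ 2) :* j :* e :* h :+ d :* h :* h))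
                refl (ι (+ j)) E (ι (+ D)) H)

module Pisano (K : ℕ) (K-coprime-6 : K % 6 ≡ 1 ⊎ K % 6 ≡ 5) where

  open KFibonacci K

  D%6≡5 : D % 6 ≡ 5
  D%6≡5 = trans (%-distribˡ-+ (K * K) 4 6)
                (trans (cong (λ x → (x + 4) % 6) (%-distribˡ-* K K 6)) (residue K-coprime-6))
    where
    residue : ∀ {r} → r ≡ 1 ⊎ r ≡ 5 → (r * r % 6 + 4) % 6 ≡ 5
    residue (inj₁ refl) = refl
    residue (inj₂ refl) = refl

  module _ {q : ℕ} (q-prime : Prime q) (q∣D : q ∣ D) where

    prime∣D⇒∤6 : ¬ q ∣ 6
    prime∣D⇒∤6 q∣6 = ¬prime[1] (subst Prime (∣1⇒≡1 (∣m+n∣m⇒∣n q∣6 q∣5)) q-prime)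
      where
      q∣5 : q ∣ 5
      q∣5 = subst (q ∣_) D%6≡5 (%-presˡ-∣ q∣D q∣6)

    prime∣D⇒∤K : ¬ q ∣ K
    prime∣D⇒∤K q∣K = [ q∤2 , q∤2 ]′ (euclidsLemma 2 2 q-prime (∣m+n∣m⇒∣n q∣D (∣m⇒∣m*n K q∣K)))
      where
      q∤2 : ¬ q ∣ 2
      q∤2 q∣2 = prime∣D⇒∤6 (∣-trans q∣2 (divides 3 refl))

  Nondegenerate : R → Set
  Nondegenerate Y = ∀ {q} → Prime q → q ∣ D → ¬ (+ q ∣ᴿ Y)

  record ExactReturn (m : ℕ) : Set where
    field
      quotient      : R
      expansion     : t ^ m ≡ 𝟙 ⊕ ι (+ m) ⊗ quotient
      nondegenerate : Nondegenerate quotient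

    congruence : t ^ m ≡ 𝟙 [mod + m ]
    congruence = quotient , expansion

  ReturnsOnlyAtMultiples : ℕ → Set
  ReturnsOnlyAtMultiples m = ∀ s → t ^ s ≡ 𝟙 [mod + m ] → m ∣ s

  ExactOrder : ℕ → Set
  ExactOrder m = ExactReturn m × ReturnsOnlyAtMultiples m

  restarts-24 : Restarts K 24 24 × (∀ {r} → r < 24 → Restarts K 24 r → r ≡ 0)
  restarts-24 = Restarts-%-cong 24 (sym K≡K%24) (proj₁ table) ,
                λ {r} r<24 restarts-r → proj₂ table r<24 (Restarts-%-cong r K≡K%24 restarts-r)
    where
    K≡K%24 : K % 24 ≡ K % 24 % 24
    K≡K%24 = sym (m%n%n≡m%n K 24)
    table : Restarts (K % 24) 24 24 × (∀ {r} → r < 24 → Restarts (K % 24) 24 r → r ≡ 0)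
    table = restarts-mod-24 (m%n<n K 24)
              (subst (λ r → r ≡ 1 ⊎ r ≡ 5) (sym (m∣n⇒o%n%m≡o%m 6 24 K (divides 4 refl))) K-coprime-6)

  t^24≡𝟙 : t ^ 24 ≡ 𝟙 [mod + 24 ]
  t^24≡𝟙 = restarts⇒t^≡𝟙 24 (proj₁ restarts-24)

  returnsOnlyAtMultiples-24 : ReturnsOnlyAtMultiples 24
  returnsOnlyAtMultiples-24 s t^s≡𝟙 = m%n≡0⇒n∣m s 24 (proj₂ restarts-24 (m%n<n s 24)
    (period⇒restarts (s % 24) (t^≡𝟙⇒period (s % 24) (^%-≡𝟙 {X = t} {s = s} t^24≡𝟙 t^s≡𝟙))))

  exactReturn-24 : ExactReturn 24
  exactReturn-24 = record { quotient = Y ; expansion = proj₂ t^24≡𝟙 ; nondegenerate = nondegenerate }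
    where
    Y H : R
    Y = proj₁ t^24≡𝟙
    H = proj₁ (t^[4j]-expansion 6)
    24Y≡6E⊕DH : ι (+ 24) ⊗ Y ≡ ι (+ 6) ⊗ E ⊕ ι (+ D) ⊗ H
    24Y≡6E⊕DH = ⊕-cancelˡ 𝟙 _ _ (trans (sym (proj₂ t^24≡𝟙)) (trans (proj₂ (t^[4j]-expansion 6))
                  (solve 3 (λ a b c → a :+ b :+ c := a :+ (b :+ c)) refl 𝟙 (ι (+ 6) ⊗ E) (ι (+ D) ⊗ H))))
    nondegenerate : Nondegenerate Y
    nondegenerate {q} q-prime q∣D q∣Y = [ prime∣D⇒∤6 q-prime q∣D , q∤E ]′ (euclid-ι⊗ 6 E q-prime q∣6E)
      where
      q∣6E : + q ∣ᴿ ι (+ 6) ⊗ E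
      q∣6E = ∣ᴿ-cancelʳ (subst (+ q ∣ᴿ_) 24Y≡6E⊕DH (∣ᴿ-⊗ˡ q∣Y (ι (+ 24)))) (∣ᴿ-trans q∣D (H , refl))
      q∤V : ¬ (+ q ∣ᴿ V)
      q∤V q∣V = prime∣D⇒∤K q-prime q∣D
        (ℤ.∣⇒∣ᵤ (subst (+ q ℤ.∣_) c₀[V]≡K (proj₁ (∣ᴿ⇒∣coefficients q∣V))))
      q∤E : ¬ (+ q ∣ᴿ E)
      q∤E q∣E = [ prime∣D⇒∤K q-prime q∣D , q∤V ]′ (euclid-ι⊗ K V q-prime q∣E)

  module Step {m : ℕ} .{{_ : NonZero m}} (4∣m : 4 ∣ m) (exact : ExactReturn m) where

    open ExactReturn exact renaming (quotient to Y)

    W Z : R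
    W = ι (+ m) ⊗ Y
    Z = ι (+ m) ⊗ (Y ⊗ Y)

    D∣ᴿW⊗W : + D ∣ᴿ W ⊗ W
    D∣ᴿW⊗W = D∣ᴿ[t^4j⊖𝟙]² j (subst (λ n → t ^ n ≡ 𝟙 ⊕ W) m≡4*j expansion)
      where
      j : ℕ
      j = _∣_.quotient 4∣m
      m≡4*j : m ≡ 4 * j
      m≡4*j = trans (_∣_.equality 4∣m) (*-comm j 4)

    prime∣D⇒∣ᴿZ : ∀ {q} → Prime q → q ∣ D → + q ∣ᴿ Z
    prime∣D⇒∣ᴿZ {q} q-prime q∣D = [ (λ q∣m → ∣ᴿ-trans q∣m (Y ⊗ Y , refl)) , (λ q∣Z → q∣Z) ]′
      (euclid-ι⊗ m Z q-prime (subst (+ q ∣ᴿ_) W⊗W≡ιm⊗Z (∣ᴿ-trans q∣D D∣ᴿW⊗W)))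
      where
      W⊗W≡ιm⊗Z : W ⊗ W ≡ ι (+ m) ⊗ Z
      W⊗W≡ιm⊗Z = solve 2 (λ m y → m :* y :* (m :* y) := m :* (m :* (y :* y))) refl (ι (+ m)) Y

    t^[m*n]-expansion : ∀ n → ∃[ S ] t ^ (m * n) ≡ 𝟙 ⊕ ι (+ m) ⊗ (ι (+ n) ⊗ Y ⊕ Z ⊗ binomial-tail n W S)
    t^[m*n]-expansion n = S , (begin
      t ^ (m * n)
        ≡⟨ sym (^-assocʳ t m n) ⟩
      (t ^ m) ^ n
        ≡⟨ cong (_^ n) expansion ⟩
      (𝟙 ⊕ W) ^ n
        ≡⟨ proj₂ (binomial W n) ⟩
      𝟙 ⊕ ι (+ n) ⊗ W ⊕ W ⊗ W ⊗ tail
        ≡⟨ solve 4 (λ m y n b → con 1ℤ :+ n :* (m :* y) :+ m :* y :* (m :* y) :* b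
                                := con 1ℤ :+ m :* (n :* y :+ m :* (y :* y) :* b))
             refl (ι (+ m)) Y (ι (+ n)) tail ⟩
      𝟙 ⊕ ι (+ m) ⊗ (ι (+ n) ⊗ Y ⊕ Z ⊗ tail)
        ∎)
      where
      open ≡-Reasoning
      S tail : R
      S = proj₁ (binomial W n)
      tail = binomial-tail n W S

    exactReturn-step : ∀ {p} → Prime p → p ∣ D → ExactReturn (m * p)
    exactReturn-step {p} p-prime p∣D = record
      { quotient = Y ⊕ Z ⊗ T
      ; expansion = begin
          t ^ (m * p)
            ≡⟨ proj₂ (t^[m*n]-expansion p) ⟩
          𝟙 ⊕ ι (+ m) ⊗ (ι (+ p) ⊗ Y ⊕ Z ⊗ tail)
            ≡⟨ cong (λ x → 𝟙 ⊕ ι (+ m) ⊗ (ι (+ p) ⊗ Y ⊕ Z ⊗ x)) (proj₂ p∣ᴿtail) ⟩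
          𝟙 ⊕ ι (+ m) ⊗ (ι (+ p) ⊗ Y ⊕ Z ⊗ (ι (+ p) ⊗ T))
            ≡⟨ cong (𝟙 ⊕_) (solve 5 (λ m p y z s → m :* (p :* y :+ z :* (p :* s))
                                                    := m :* (p :* (y :+ z :* s)))
                                     refl (ι (+ m)) (ι (+ p)) Y Z T) ⟩
          𝟙 ⊕ ι (+ m) ⊗ (ι (+ p) ⊗ (Y ⊕ Z ⊗ T))
            ≡⟨ cong (𝟙 ⊕_) (sym (ι[a*b]⊗X m p (Y ⊕ Z ⊗ T))) ⟩
          𝟙 ⊕ ι (+ (m * p)) ⊗ (Y ⊕ Z ⊗ T)
            ∎
      ; nondegenerate = λ q-prime q∣D q∣Y′ →
          nondegenerate q-prime q∣D (∣ᴿ-cancelʳ q∣Y′ (∣ᴿ-⊗ʳ (prime∣D⇒∣ᴿZ q-prime q∣D) T))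
      }
      where
      open ≡-Reasoning
      p∤6 : ¬ p ∣ 6
      p∤6 = prime∣D⇒∤6 p-prime p∣D
      tail : R
      tail = binomial-tail p W (proj₁ (t^[m*n]-expansion p))
      p∣ᴿtail : + p ∣ᴿ tail
      p∣ᴿtail = ∣ᴿ-⊕ (∣ᴿ-⊕ (∣⇒∣ᴿι (prime∤6⇒∣pC2 p-prime p∤6))
                           (∣ᴿ-⊗ʳ (∣⇒∣ᴿι (prime∤6⇒∣pC3 p-prime p∤6)) W))
                     (∣ᴿ-⊗ʳ (∣ᴿ-trans p∣D D∣ᴿW⊗W) (proj₁ (t^[m*n]-expansion p)))
      T : R
      T = proj₁ p∣ᴿtail

    returnsOnlyAtMultiples-step : ∀ {p} → Prime p → p ∣ D →
                                  ReturnsOnlyAtMultiples m → ReturnsOnlyAtMultiples (m * p)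
    returnsOnlyAtMultiples-step {p} p-prime p∣D m∣returns s t^s≡𝟙 =
      subst (m * p ∣_) (sym s≡m*w) (*-monoʳ-∣ m p∣w)
      where
      open ≡-Reasoning
      m∣s : m ∣ s
      m∣s = m∣returns s (≡[mod*]⇒≡[mod] m p t^s≡𝟙)
      w : ℕ
      w = _∣_.quotient m∣s
      s≡m*w : s ≡ m * w
      s≡m*w = trans (_∣_.equality m∣s) (*-comm w m)
      B A : R
      B = proj₁ t^s≡𝟙
      A = ι (+ w) ⊗ Y ⊕ Z ⊗ binomial-tail w W (proj₁ (t^[m*n]-expansion w))
      A≡pB : A ≡ ι (+ p) ⊗ B
      A≡pB = ι-cancelˡ (+ m) (⊕-cancelˡ 𝟙 _ _ (begin
        𝟙 ⊕ ι (+ m) ⊗ A              ≡⟨ sym (proj₂ (t^[m*n]-expansion w)) ⟩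
        t ^ (m * w)                  ≡⟨ cong (t ^_) (sym s≡m*w) ⟩
        t ^ s                        ≡⟨ proj₂ t^s≡𝟙 ⟩
        𝟙 ⊕ ι (+ (m * p)) ⊗ B        ≡⟨ cong (𝟙 ⊕_) (ι[a*b]⊗X m p B) ⟩
        𝟙 ⊕ ι (+ m) ⊗ (ι (+ p) ⊗ B)  ∎))
      p∣w : p ∣ w
      p∣w = [ (λ p∣w → p∣w) , (λ p∣Y → ⊥-elim (nondegenerate p-prime p∣D p∣Y)) ]′
        (euclid-ι⊗ w Y p-prime (∣ᴿ-cancelʳ (B , A≡pB) (∣ᴿ-⊗ʳ (prime∣D⇒∣ᴿZ p-prime p∣D) _)))

  exactOrder-24·product : ∀ {ps} → All Prime ps → (∀ {q} → Prime q → q ∣ product ps → q ∣ D) →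
                          ExactOrder (24 * product ps)
  exactOrder-24·product [] _ = exactReturn-24 , returnsOnlyAtMultiples-24
  exactOrder-24·product {p ∷ ps} (p-prime ∷ ps-prime) support = subst ExactOrder 24·x·p≡24·[p·x]
    (exactReturn-step p-prime p∣D , returnsOnlyAtMultiples-step p-prime p∣D (proj₂ previous))
    where
    previous : ExactOrder (24 * product ps)
    previous = exactOrder-24·product ps-prime (λ q-prime q∣ → support q-prime (∣n⇒∣m*n p q∣))
    p∣D : p ∣ D
    p∣D = support p-prime (m∣m*n (product ps))
    24·x·p≡24·[p·x] : 24 * product ps * p ≡ 24 * (p * product ps)
    24·x·p≡24·[p·x] = trans (*-assoc 24 (product ps) p) (cong (24 *_) (*-comm (product ps) p))
    instance
      product≢0 : NonZero (product ps)
      product≢0 = productOfPrimes≢0 ps-prime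
    open Step {{m*n≢0 24 (product ps)}} (∣m⇒∣m*n (product ps) (divides 6 refl)) (proj₁ previous)

  exactOrder-24·d : ∀ d .{{_ : NonZero d}} → PrimeSupportIn d D → ExactOrder (24 * d)
  exactOrder-24·d d support = subst (λ n → ExactOrder (24 * n)) (sym isFactorisation)
    (exactOrder-24·product factorsPrime
       (λ {q} q-prime q∣ → support q q-prime (subst (q ∣_) (sym isFactorisation) q∣)))
    where open PrimeFactorisation (factorise d)

theorem3p1 : (K : ℕ) → 1 ≤ K → (K % 6 ≡ 1 ⊎ K % 6 ≡ 5) →
    (d : ℕ) → .{{_ : NonZero d}} → PrimeSupportIn d (K * K + 4) →
    .{{_ : NonZero (24 * d)}} → IsPisano K (24 * d) (24 * d)
theorem3p1 K _ K-coprime-6 d support = -- 1 ≤ K is implied by the congruence condition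
  order≡m⇒isPisano (24 * d) (ExactReturn.congruence exact) returnsOnlyAtMultiples
  where
  open KFibonacci K using (order≡m⇒isPisano)
  open Pisano K K-coprime-6
  exact : ExactReturn (24 * d)
  exact = proj₁ (exactOrder-24·d d support)
  returnsOnlyAtMultiples : ReturnsOnlyAtMultiples (24 * d)
  returnsOnlyAtMultiples = proj₂ (exactOrder-24·d d support)
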